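{- Let $k\ge 3$ be odd and let $G=v_0v_1\cdots v_{k-1}v_0$ be a cycle of length $k$. Let $i,j\in\{0,\dots,k-1\}$ and let $\omega$ assign colors in $\{0,\dots,k-1\}$ to $v_i,v_j$ such that $\omega$ is a $C_k$-coloring of the induced subgraph $G[\{v_i,v_j\}]$. Then $\omega$ extends to a $C_k$-coloring of $G$ if and only if $$\omega(v_i)-\omega(v_j)\equiv \tfrac{k-1}{2}(i-j)\quad\text{or}\quad \omega(v_i)-\omega(v_j)\equiv\tfrac{k+1}{2}(i-j)\pmod{k}.$$
   Context: For an odd integer $k\ge 3$, a $C_k$-coloring of a graph $H$ is a map $\varphi:V(H)\to\{0,1,\dots,k-1\}$ such that $\frac{k-1}{2}\le|\varphi(u)-\varphi(v)|\le \frac{k+1}{2}$ for every edge $uv$. -}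

module Defs where

open import Data.Nat using (ℕ; zero; suc; _+_; _∸_; _≤_; ∣_-_∣; _/_)
open import Data.Fin using (Fin; toℕ)
open import Data.Product using (_×_)
open import Data.Sum using (_⊎_)
open import Relation.Binary.PropositionalEquality using (_≡_)
open import Data.Integer as ℤ using (ℤ; +_)
open import Data.Integer.Divisibility as ℤD using ()

-- The cycle G = v_0 v_1 ... v_{k-1} v_0 on vertex set Fin k:
-- v_u is adjacent to v_(u+1 mod k).
Succ : (k : ℕ) → Fin k → Fin k → Set
Succ k u v = (toℕ v ≡ suc (toℕ u)) ⊎ (suc (toℕ u) ≡ k × toℕ v ≡ 0)

CycleAdj : (k : ℕ) → Fin k → Fin k → Set
CycleAdj k u v = Succ k u v ⊎ Succ k v u

OkPair : (k : ℕ) → Fin k → Fin k → Set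
OkPair k a b = ((k ∸ 1) / 2 ≤ ∣ toℕ a - toℕ b ∣) × (∣ toℕ a - toℕ b ∣ ≤ (k + 1) / 2)

IsCkColoringCycle : (k : ℕ) → (Fin k → Fin k) → Set
IsCkColoringCycle k φ = ∀ u v → CycleAdj k u v → OkPair k (φ u) (φ v)

_≡_[mod_] : ℤ → ℤ → ℕ → Set
x ≡ y [mod k ] = (+ k) ℤD.∣ (x ℤ.- y)

-- Write k = 2m + 1. Two colours x, y < k satisfy m ≤ ∣x − y∣ ≤ m + 1 exactly when
-- y ≡ x + m or y ≡ x + m + 1 (mod k). Along a C_k-colouring of the cycle the colour thus
-- advances by m + e_t with e_t ∈ {0, 1} at every edge; going once around gives
-- k·m + Σ e_t ≡ 0 with 0 ≤ Σ e_t ≤ k, so all e_t are equal and the colouring is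
-- t ↦ φ(v_0) + t·c with c ∈ {m, m + 1}, which yields the congruence. Conversely
-- t ↦ ω(v_i) + (t − i)·c mod k is such a colouring, and the congruence says exactly
-- that it takes the value ω(v_j) at v_j.
module Submission where

open import Defs
open import Data.Nat using (ℕ; _≤_; _%_; _/_; _∸_; _+_)
open import Data.Fin using (Fin; toℕ)
open import Data.Product using (_×_; ∃)
open import Data.Sum using (_⊎_)
open import Function.Bundles using (_⇔_)
open import Relation.Binary.PropositionalEquality using (_≡_)
open import Data.Integer as ℤ using (+_)
open import Data.Nat using (zero; suc; _*_; _<_; z≤n; s≤s; ∣_-_∣; NonZero; _<?_)
import Data.Nat as ℕ using (>-nonZero⁻¹)
import Data.Nat.Properties as ℕP
open import Data.Nat.DivMod using (m*n/n≡m; m≡m%n+[m/n]*n)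
import Data.Nat.Divisibility as ℕD
import Data.Nat.Tactic.RingSolver as ℕRing
open import Data.Integer using (ℤ)
import Data.Integer.Properties as ℤP
import Data.Integer.Divisibility as ℤD
import Data.Integer.Divisibility.Signed as ℤS
open import Data.Integer.DivMod using (_%ℕ_; _/ℕ_; n%ℕd<d; a≡a%ℕn+[a/ℕn]*n)
import Data.Integer.Tactic.RingSolver as ℤRing
open import Data.Fin using (fromℕ<)
import Data.Fin.Properties as FinP
open import Data.Product using (_,_; proj₁; proj₂; ∃-syntax)
open import Data.Sum using (inj₁; inj₂)
open import Function.Bundles using (mk⇔)
open import Function.Base using (_∘_)
open import Relation.Binary.Bundles using (Setoid)
open import Relation.Binary.Structures using (IsEquivalence)
open import Relation.Binary.PropositionalEquality using (refl; sym; trans; cong; cong₂; subst; module ≡-Reasoning)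
open import Relation.Nullary using (yes; no; contradiction)

sumBelow : (ℕ → ℕ) → ℕ → ℕ
sumBelow g zero = 0
sumBelow g (suc n) = sumBelow g n + g n

sumBelow-+ : ∀ f g n → sumBelow (λ t → f t + g t) n ≡ sumBelow f n + sumBelow g n
sumBelow-+ f g zero = refl
sumBelow-+ f g (suc n) =
  trans (cong (_+ (f n + g n)) (sumBelow-+ f g n)) (shuffle (sumBelow f n) (sumBelow g n) (f n) (g n))
  where
  shuffle : ∀ a b c d → (a + b) + (c + d) ≡ (a + c) + (b + d)
  shuffle = ℕRing.solve-∀

sumBelow-const : ∀ {g c} n → (∀ t → t < n → g t ≡ c) → sumBelow g n ≡ n * c
sumBelow-const zero _ = refl
sumBelow-const {g} {c} (suc n) g≡c = begin
  sumBelow g n + g n ≡⟨ cong₂ _+_ (sumBelow-const n (λ t t<n → g≡c t (ℕP.m<n⇒m<1+n t<n)))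
                                  (g≡c n (ℕP.n<1+n n)) ⟩
  n * c + c          ≡⟨ ℕP.+-comm (n * c) c ⟩
  suc n * c          ∎
  where open ≡-Reasoning

m+o≡1+n⇒m≡n∧o≡1 : ∀ {m n o} → m ≤ n → o ≤ 1 → m + o ≡ suc n → m ≡ n × o ≡ 1
m+o≡1+n⇒m≡n∧o≡1 {m} {n} m≤n z≤n m+0≡1+n =
  contradiction (subst (_≤ n) (trans (sym (ℕP.+-identityʳ m)) m+0≡1+n) m≤n) ℕP.1+n≰n
m+o≡1+n⇒m≡n∧o≡1 {m} {n} _ (s≤s z≤n) m+1≡1+n = ℕP.+-cancelʳ-≡ 1 m n (trans m+1≡1+n (ℕP.+-comm 1 n)) , refl

module _ {g : ℕ → ℕ} (g≤1 : ∀ t → g t ≤ 1) where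

  sumBelow-≤ : ∀ n → sumBelow g n ≤ n
  sumBelow-≤ zero = z≤n
  sumBelow-≤ (suc n) = subst (sumBelow g n + g n ≤_) (ℕP.+-comm n 1) (ℕP.+-mono-≤ (sumBelow-≤ n) (g≤1 n))

  sumBelow≡0⇒≡0 : ∀ n → sumBelow g n ≡ 0 → ∀ t → t < n → g t ≡ 0
  sumBelow≡0⇒≡0 (suc n) S≡0 t (s≤s t≤n) with ℕP.m≤n⇒m<n∨m≡n t≤n
  ... | inj₁ t<n = sumBelow≡0⇒≡0 n (ℕP.m+n≡0⇒m≡0 (sumBelow g n) S≡0) t t<n
  ... | inj₂ refl = ℕP.m+n≡0⇒n≡0 (sumBelow g n) S≡0

  sumBelow≡n⇒≡1 : ∀ n → sumBelow g n ≡ n → ∀ t → t < n → g t ≡ 1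
  sumBelow≡n⇒≡1 (suc n) S≡1+n t (s≤s t≤n) with m+o≡1+n⇒m≡n∧o≡1 (sumBelow-≤ n) (g≤1 n) S≡1+n
                                                | ℕP.m≤n⇒m<n∨m≡n t≤n
  ... | S≡n , _ | inj₁ t<n = sumBelow≡n⇒≡1 n S≡n t t<n
  ... | _ , g≡1 | inj₂ refl = g≡1

∣∧<⇒≡0 : ∀ {k n} → k ℕD.∣ n → n < k → n ≡ 0
∣∧<⇒≡0 {n = zero} _ _ = refl
∣∧<⇒≡0 {n = suc n} k∣n n<k = contradiction k∣n (ℕD.>⇒∤ n<k)

∣∧≤⇒≡0⊎≡ : ∀ {k n} → k ℕD.∣ n → n ≤ k → n ≡ 0 ⊎ n ≡ k
∣∧≤⇒≡0⊎≡ k∣n n≤k with ℕP.m≤n⇒m<n∨m≡n n≤k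
... | inj₁ n<k = inj₁ (∣∧<⇒≡0 k∣n n<k)
... | inj₂ n≡k = inj₂ n≡k

module Congruence (k : ℕ) where

  -- _≡_[mod k ] hides its two sides under ∣_∣, so Agda cannot infer them; this record exposes them.
  infix 4 _≈_
  record _≈_ (x y : ℤ) : Set where
    constructor wrap
    field unwrap : x ≡ y [mod k ]
  open _≈_ public

  private
    signed : ∀ {x y} → x ≈ y → + k ℤS.∣ (x ℤ.- y)
    signed {x} {y} (wrap p) = ℤS.∣ᵤ⇒∣ {i = x ℤ.- y} p

    unsigned : ∀ {x y} → + k ℤS.∣ (x ℤ.- y) → x ≈ y
    unsigned {x} {y} p = wrap (ℤS.∣⇒∣ᵤ {i = x ℤ.- y} p)

  ≈-by-difference : ∀ {x y u v} → x ℤ.- y ≡ u ℤ.- v → x ≈ y → u ≈ v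
  ≈-by-difference eq (wrap p) = wrap (subst (+ k ℤD.∣_) eq p)

  ≈-reflexive : ∀ {x y} → x ≡ y → x ≈ y
  ≈-reflexive {x} refl = wrap (subst (+ k ℤD.∣_) (sym (ℤP.+-inverseʳ x)) (k ℕD.∣0))

  ≈-sym : ∀ {x y} → x ≈ y → y ≈ x
  ≈-sym {x} {y} (wrap p) = wrap (subst (k ℕD.∣_) (ℤP.∣i-j∣≡∣j-i∣ x y) p)

  ≈-trans : ∀ {x y z} → x ≈ y → y ≈ z → x ≈ z
  ≈-trans {x} {y} {z} p q =
    unsigned (subst (+ k ℤS.∣_) (sym (diff x y z)) (ℤS.∣m∣n⇒∣m+n (signed p) (signed q)))
    where
    diff : ∀ x y z → x ℤ.- z ≡ (x ℤ.- y) ℤ.+ (y ℤ.- z)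
    diff = ℤRing.solve-∀

  ≈-isEquivalence : IsEquivalence _≈_
  ≈-isEquivalence = record { refl = ≈-reflexive refl ; sym = ≈-sym ; trans = ≈-trans }

  ≈-setoid : Setoid _ _
  ≈-setoid = record { isEquivalence = ≈-isEquivalence }

  +-cong : ∀ {x y u v} → x ≈ y → u ≈ v → x ℤ.+ u ≈ y ℤ.+ v
  +-cong {x} {y} {u} {v} p q =
    unsigned (subst (+ k ℤS.∣_) (sym (diff x y u v)) (ℤS.∣m∣n⇒∣m+n (signed p) (signed q)))
    where
    diff : ∀ x y u v → (x ℤ.+ u) ℤ.- (y ℤ.+ v) ≡ (x ℤ.- y) ℤ.+ (u ℤ.- v)
    diff = ℤRing.solve-∀

  -cong : ∀ {x y u v} → x ≈ y → u ≈ v → x ℤ.- u ≈ y ℤ.- v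
  -cong {x} {y} {u} {v} p q =
    unsigned (subst (+ k ℤS.∣_) (sym (diff x y u v)) (ℤS.∣m∣n⇒∣m-n (signed p) (signed q)))
    where
    diff : ∀ x y u v → (x ℤ.- u) ℤ.- (y ℤ.- v) ≡ (x ℤ.- y) ℤ.- (u ℤ.- v)
    diff = ℤRing.solve-∀

  +-multiple : ∀ x q → x ℤ.+ q ℤ.* + k ≈ x
  +-multiple x q = unsigned (subst (+ k ℤS.∣_) (sym (diff x q (+ k))) (ℤS.∣n⇒∣m*n q ℤS.∣-refl))
    where
    diff : ∀ x q k → (x ℤ.+ q ℤ.* k) ℤ.- x ≡ q ℤ.* k
    diff = ℤRing.solve-∀

  +-modulus : ∀ x → x ℤ.+ + k ≈ x
  +-modulus x = subst (λ y → x ℤ.+ y ≈ x) (ℤP.*-identityˡ (+ k)) (+-multiple x (+ 1))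

  x≈x+y⇒∣y : ∀ {x y} → x ≈ x ℤ.+ y → + k ℤD.∣ y
  x≈x+y⇒∣y {x} {y} (wrap p) = subst (k ℕD.∣_) (trans (cong ℤ.∣_∣ (diff x y)) (ℤP.∣-i∣≡∣i∣ y)) p
    where
    diff : ∀ x y → x ℤ.- (x ℤ.+ y) ≡ ℤ.- y
    diff = ℤRing.solve-∀

  telescope : ∀ (f : ℕ → ℤ) g → (∀ t → f (suc t) ≈ f t ℤ.+ + g t) →
              ∀ n → f n ≈ f 0 ℤ.+ + sumBelow g n
  telescope f g step zero = ≈-reflexive (sym (ℤP.+-identityʳ (f 0)))
  telescope f g step (suc n) = begin
    f (suc n)                                ≈⟨ step n ⟩
    f n ℤ.+ + g n                            ≈⟨ +-cong (telescope f g step n) (≈-reflexive refl) ⟩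
    f 0 ℤ.+ + sumBelow g n ℤ.+ + g n         ≡⟨ ℤP.+-assoc (f 0) (+ sumBelow g n) (+ g n) ⟩
    f 0 ℤ.+ + sumBelow g (suc n)             ∎
    where open import Relation.Binary.Reasoning.Setoid ≈-setoid

module Residues (k : ℕ) .{{_ : NonZero k}} where
  open Congruence k

  private
    ≤∧≈⇒≡ : ∀ {r s} → r ≤ s → s < k → + r ≈ + s → r ≡ s
    ≤∧≈⇒≡ {r} {s} r≤s s<k r≈s with s ∸ r | ℕP.m+[n∸m]≡n r≤s
    ... | d | refl = sym (trans (cong (_+_ r) d≡0) (ℕP.+-identityʳ r))
      where
      d≡0 : d ≡ 0
      d≡0 = ∣∧<⇒≡0 (x≈x+y⇒∣y {y = + d} r≈s) (ℕP.≤-<-trans (ℕP.m≤n+m d r) s<k)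

  ≈⇒≡ : ∀ {r s} → r < k → s < k → + r ≈ + s → r ≡ s
  ≈⇒≡ {r} {s} r<k s<k r≈s with ℕP.≤-total r s
  ... | inj₁ r≤s = ≤∧≈⇒≡ r≤s s<k r≈s
  ... | inj₂ s≤r = sym (≤∧≈⇒≡ s≤r r<k (≈-sym r≈s))

  residue : ℤ → Fin k
  residue x = fromℕ< (n%ℕd<d x k)

  residue-≈ : ∀ x → + toℕ (residue x) ≈ x
  residue-≈ x = begin
    + toℕ (residue x)                 ≡⟨ cong +_ (FinP.toℕ-fromℕ< (n%ℕd<d x k)) ⟩
    + (x %ℕ k)                        ≈⟨ +-multiple (+ (x %ℕ k)) (x /ℕ k) ⟨
    + (x %ℕ k) ℤ.+ (x /ℕ k) ℤ.* + k   ≡⟨ a≡a%ℕn+[a/ℕn]*n x k ⟨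
    x                                 ∎
    where open import Relation.Binary.Reasoning.Setoid ≈-setoid

  residue-unique : ∀ x a → x ≈ + toℕ a → residue x ≡ a
  residue-unique x a x≡a = FinP.toℕ-injective
    (≈⇒≡ (FinP.toℕ<n (residue x)) (FinP.toℕ<n a) (≈-trans (residue-≈ x) x≡a))

  residue-cong : ∀ {x y} → x ≈ y → residue x ≡ residue y
  residue-cong {x} {y} x≈y = residue-unique x (residue y) (≈-trans x≈y (≈-sym (residue-≈ y)))

  ≈-suc⇒Succ : ∀ u v → + toℕ v ≈ + suc (toℕ u) → Succ k u v
  ≈-suc⇒Succ u v v≈1+u with ℕP.m≤n⇒m<n∨m≡n (FinP.toℕ<n u)
  ... | inj₁ 1+u<k = inj₁ (≈⇒≡ (FinP.toℕ<n v) 1+u<k v≈1+u)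
  ... | inj₂ 1+u≡k = inj₂ (1+u≡k , ≈⇒≡ (FinP.toℕ<n v) (ℕ.>-nonZero⁻¹ k) (begin
      + toℕ v          ≈⟨ v≈1+u ⟩
      + suc (toℕ u)    ≡⟨ cong +_ 1+u≡k ⟩
      + 0 ℤ.+ + k      ≈⟨ +-modulus (+ 0) ⟩
      + 0              ∎))
    where open import Relation.Binary.Reasoning.Setoid ≈-setoid

  residue-suc : ∀ t → Succ k (residue (+ t)) (residue (+ suc t))
  residue-suc t = ≈-suc⇒Succ (residue (+ t)) (residue (+ suc t))
    (≈-trans (residue-≈ (+ suc t)) (≈-sym (+-cong (≈-reflexive {+ 1} refl) (residue-≈ (+ t)))))

  y≈x+c⇒y≡x+c⊎x≡y+[k∸c] : ∀ {x y c} → x < k → y < k → c ≤ k → + y ≈ + x ℤ.+ + c →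
                          y ≡ x + c ⊎ x ≡ y + (k ∸ c)
  y≈x+c⇒y≡x+c⊎x≡y+[k∸c] {x} {y} {c} x<k y<k c≤k y≈x+c with x + c <? k
  ... | yes x+c<k = inj₁ (≈⇒≡ y<k x+c<k y≈x+c)
  ... | no x+c≮k = inj₂ (ℕP.+-cancelʳ-≡ c x (y + (k ∸ c)) (begin
      x + c             ≡⟨ r+k≡x+c ⟨
      r + k             ≡⟨ cong (_+ k) y≡r ⟨
      y + k             ≡⟨ cong (_+_ y) (ℕP.m∸n+n≡m c≤k) ⟨
      y + (k ∸ c + c)   ≡⟨ ℕP.+-assoc y (k ∸ c) c ⟨
      y + (k ∸ c) + c   ∎))
    where
    open ≡-Reasoning
    r : ℕ
    r = x + c ∸ k
    r+k≡x+c : r + k ≡ x + c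
    r+k≡x+c = ℕP.m∸n+n≡m (ℕP.≮⇒≥ x+c≮k)
    r<k : r < k
    r<k = ℕP.+-cancelʳ-< k r k (subst (_< k + k) (sym r+k≡x+c) (ℕP.+-mono-<-≤ x<k c≤k))
    y≡r : y ≡ r
    y≡r = ≈⇒≡ y<k r<k (≈-trans y≈x+c (≈-trans (≈-reflexive (cong +_ (sym r+k≡x+c))) (+-modulus (+ r))))

∣m-m+n∣≡n : ∀ m n → ∣ m - m + n ∣ ≡ n
∣m-m+n∣≡n m n = trans (ℕP.m≤n⇒∣m-n∣≡n∸m (ℕP.m≤m+n m n)) (ℕP.m+n∸m≡n m n)

∣m+n-m∣≡n : ∀ m n → ∣ m + n - m ∣ ≡ n
∣m+n-m∣≡n m n = trans (ℕP.∣-∣-comm (m + n) m) (∣m-m+n∣≡n m n)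

module OddCycle (m : ℕ) where

  k : ℕ
  k = suc (m + m)

  open Congruence k
  open Residues k

  [k∸1]/2≡m : (k ∸ 1) / 2 ≡ m
  [k∸1]/2≡m = trans (cong (_/ 2) (m+m≡m*2 m)) (m*n/n≡m m 2)
    where
    m+m≡m*2 : ∀ m → m + m ≡ m * 2
    m+m≡m*2 = ℕRing.solve-∀

  [k+1]/2≡1+m : (k + 1) / 2 ≡ suc m
  [k+1]/2≡1+m = trans (cong (_/ 2) (k+1≡[1+m]*2 m)) (m*n/n≡m (suc m) 2)
    where
    k+1≡[1+m]*2 : ∀ m → suc (m + m) + 1 ≡ suc m * 2
    k+1≡[1+m]*2 = ℕRing.solve-∀

  Adjacent : ℕ → ℕ → Set
  Adjacent x y = m ≤ ∣ x - y ∣ × ∣ x - y ∣ ≤ suc m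

  okPair⇒adjacent : ∀ {a b} → OkPair k a b → Adjacent (toℕ a) (toℕ b)
  okPair⇒adjacent {a} {b} (lo , hi) = subst (_≤ ∣ toℕ a - toℕ b ∣) [k∸1]/2≡m lo ,
                                      subst (∣ toℕ a - toℕ b ∣ ≤_) [k+1]/2≡1+m hi

  adjacent⇒okPair : ∀ {a b} → Adjacent (toℕ a) (toℕ b) → OkPair k a b
  adjacent⇒okPair {a} {b} (lo , hi) = subst (_≤ ∣ toℕ a - toℕ b ∣) (sym [k∸1]/2≡m) lo ,
                                      subst (∣ toℕ a - toℕ b ∣ ≤_) (sym [k+1]/2≡1+m) hi

  adjacent-sym : ∀ {x y} → Adjacent x y → Adjacent y x
  adjacent-sym {x} {y} = subst (λ d → m ≤ d × d ≤ suc m) (ℕP.∣-∣-comm x y)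

  Step : ℕ → ℕ → Set
  Step x y = ∃[ e ] e ≤ 1 × + y ≈ + x ℤ.+ + (m + e)

  adjacent⇒step : ∀ x y → Adjacent x y → Step x y
  adjacent⇒step x y adj with ℕP.≤-total x y
  ... | inj₁ x≤y with y ∸ x | ℕP.m+[n∸m]≡n x≤y
  ...   | d | refl = d ∸ m , ℕP.m≤n+o⇒m∸n≤o d m (subst (d ≤_) (ℕP.+-comm 1 m) hi) ,
                     ≈-reflexive (cong (λ n → + (x + n)) (sym (ℕP.m+[n∸m]≡n lo)))
    where
    lo : m ≤ d
    lo = subst (m ≤_) (∣m-m+n∣≡n x d) (proj₁ adj)
    hi : d ≤ suc m
    hi = subst (_≤ suc m) (∣m-m+n∣≡n x d) (proj₂ adj)
  adjacent⇒step x y adj | inj₂ y≤x with x ∸ y | ℕP.m+[n∸m]≡n y≤x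
  ...   | d | refl = suc m ∸ d , ℕP.m≤n+o⇒m∸n≤o (suc m) d (subst (suc m ≤_) (ℕP.+-comm 1 d) (s≤s lo)) ,
                     ≈-sym (≈-trans (≈-reflexive (cong +_ wrap-around)) (+-modulus (+ y)))
    where
    lo : m ≤ d
    lo = subst (m ≤_) (∣m+n-m∣≡n y d) (proj₁ adj)
    hi : d ≤ suc m
    hi = subst (_≤ suc m) (∣m+n-m∣≡n y d) (proj₂ adj)
    wrap-around : y + d + (m + (suc m ∸ d)) ≡ y + k
    wrap-around = begin
      y + d + (m + (suc m ∸ d))  ≡⟨ shuffle y d m (suc m ∸ d) ⟩
      y + (m + (d + (suc m ∸ d))) ≡⟨ cong (λ n → y + (m + n)) (ℕP.m+[n∸m]≡n hi) ⟩
      y + (m + suc m)            ≡⟨ cong (_+_ y) (ℕP.+-suc m m) ⟩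
      y + k                      ∎
      where
      open ≡-Reasoning
      shuffle : ∀ y d m e → y + d + (m + e) ≡ y + (m + (d + e))
      shuffle = ℕRing.solve-∀

  m+e≤k : ∀ {e} → e ≤ 1 → m + e ≤ k
  m+e≤k e≤1 = ℕP.≤-trans (ℕP.+-monoʳ-≤ m e≤1) (subst (_≤ k) (ℕP.+-comm 1 m) (s≤s (ℕP.m≤m+n m m)))

  step⇒adjacent : ∀ {x y} → x < k → y < k → Step x y → Adjacent x y
  step⇒adjacent {x} {y} x<k y<k (e , e≤1 , y≈x+c) with y≈x+c⇒y≡x+c⊎x≡y+[k∸c] x<k y<k (m+e≤k e≤1) y≈x+c
  ... | inj₁ refl = subst (λ d → m ≤ d × d ≤ suc m) (sym (∣m-m+n∣≡n x (m + e)))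
                          (ℕP.m≤m+n m e , subst (m + e ≤_) (ℕP.+-comm m 1) (ℕP.+-monoʳ-≤ m e≤1))
  ... | inj₂ refl = subst (λ d → m ≤ d × d ≤ suc m) (sym (trans (∣m+n-m∣≡n y (k ∸ (m + e))) k∸c≡1+m∸e))
                          (ℕP.∸-monoʳ-≤ (suc m) e≤1 , ℕP.m∸n≤m (suc m) e)
    where
    k∸c≡1+m∸e : k ∸ (m + e) ≡ suc m ∸ e
    k∸c≡1+m∸e = trans (cong (_∸ (m + e)) (sym (ℕP.+-suc m m))) (ℕP.[m+n]∸[m+o]≡n∸o m (suc m) e)

  Extendable : (i j a b : Fin k) → Set
  Extendable i j a b = ∃ λ φ → IsCkColoringCycle k φ × φ i ≡ a × φ j ≡ b

  Congruent : ℕ → (i j a b : Fin k) → Set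
  Congruent c i j a b = + toℕ a ℤ.- + toℕ b ≈ + c ℤ.* (+ toℕ i ℤ.- + toℕ j)

  module Colouring (φ : Fin k → Fin k) (φ-colouring : IsCkColoringCycle k φ) where

    colour : ℕ → ℕ
    colour t = toℕ (φ (residue (+ t)))

    colour-toℕ : ∀ u → colour (toℕ u) ≡ toℕ (φ u)
    colour-toℕ u = cong (λ v → toℕ (φ v)) (residue-unique (+ toℕ u) u (≈-reflexive refl))

    step : ∀ t → Step (colour t) (colour (suc t))
    step t = adjacent⇒step (colour t) (colour (suc t))
      (okPair⇒adjacent {φ (residue (+ t))} {φ (residue (+ suc t))} (φ-colouring _ _ (inj₁ (residue-suc t))))

    bit : ℕ → ℕ
    bit t = proj₁ (step t)

    bit≤1 : ∀ t → bit t ≤ 1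
    bit≤1 t = proj₁ (proj₂ (step t))

    colour-telescope : ∀ n → + colour n ≈ + colour 0 ℤ.+ + sumBelow (λ t → m + bit t) n
    colour-telescope = telescope (λ t → + colour t) (λ t → m + bit t) (λ t → proj₂ (proj₂ (step t)))

    k∣sum-bits : k ℕD.∣ sumBelow bit k
    k∣sum-bits = ℕD.∣m+n∣m⇒∣n (subst (k ℕD.∣_) sum≡ k∣sum) (ℕD.m∣m*n m)
      where
      cycle-closes : + colour 0 ≈ + colour 0 ℤ.+ + sumBelow (λ t → m + bit t) k
      cycle-closes = ≈-trans (≈-reflexive (cong (λ v → + toℕ (φ v)) (sym (residue-cong (+-modulus (+ 0))))))
                             (colour-telescope k)
      k∣sum : k ℕD.∣ sumBelow (λ t → m + bit t) k
      k∣sum = x≈x+y⇒∣y {y = + sumBelow (λ t → m + bit t) k} cycle-closes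
      sum≡ : sumBelow (λ t → m + bit t) k ≡ k * m + sumBelow bit k
      sum≡ = trans (sumBelow-+ (λ _ → m) bit k) (cong (_+ sumBelow bit k) (sumBelow-const k (λ _ _ → refl)))

    bit-constant : ∃[ ε ] ε ≤ 1 × (∀ t → t < k → bit t ≡ ε)
    bit-constant = constant (∣∧≤⇒≡0⊎≡ k∣sum-bits (sumBelow-≤ bit≤1 k))
      where
      constant : sumBelow bit k ≡ 0 ⊎ sumBelow bit k ≡ k → ∃[ ε ] ε ≤ 1 × (∀ t → t < k → bit t ≡ ε)
      constant (inj₁ S≡0) = 0 , z≤n , sumBelow≡0⇒≡0 bit≤1 k S≡0
      constant (inj₂ S≡k) = 1 , ℕP.≤-refl , sumBelow≡n⇒≡1 bit≤1 k S≡k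

    colour-linear : ∃[ ε ] ε ≤ 1 × (∀ n → n ≤ k → + colour n ≈ + colour 0 ℤ.+ + (n * (m + ε)))
    colour-linear =
      let ε , ε≤1 , bit≡ε = bit-constant
      in ε , ε≤1 , λ n n≤k →
        subst (λ s → + colour n ≈ + colour 0 ℤ.+ + s)
              (sumBelow-const n (λ t t<n → cong (_+_ m) (bit≡ε t (ℕP.<-≤-trans t<n n≤k))))
              (colour-telescope n)

  extension⇒congruent : ∀ {i j a b} → Extendable i j a b → ∃[ ε ] ε ≤ 1 × Congruent (m + ε) i j a b
  extension⇒congruent {i} {j} {a} {b} (φ , φ-colouring , φi≡a , φj≡b) =
    let ε , ε≤1 , linear = colour-linear in ε , ε≤1 , congruent linear
    where
    open Colouring φ φ-colouring
    open import Relation.Binary.Reasoning.Setoid ≈-setoid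

    colour≡ : ∀ u {v} → φ u ≡ v → colour (toℕ u) ≡ toℕ v
    colour≡ u refl = colour-toℕ u

    toℕ≤k : ∀ (u : Fin k) → toℕ u ≤ k
    toℕ≤k u = ℕP.<⇒≤ (FinP.toℕ<n u)

    difference : ∀ F I J C → (F ℤ.+ I ℤ.* C) ℤ.- (F ℤ.+ J ℤ.* C) ≡ C ℤ.* (I ℤ.- J)
    difference = ℤRing.solve-∀

    congruent : ∀ {c} → (∀ n → n ≤ k → + colour n ≈ + colour 0 ℤ.+ + (n * c)) → Congruent c i j a b
    congruent {c} linear = begin
      + toℕ a ℤ.- + toℕ b                                   ≡⟨ cong₂ (λ p q → + p ℤ.- + q) (colour≡ i φi≡a) (colour≡ j φj≡b) ⟨
      + colour i' ℤ.- + colour j'                           ≈⟨ -cong (linear i' (toℕ≤k i)) (linear j' (toℕ≤k j)) ⟩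
      (F ℤ.+ + (i' * c)) ℤ.- (F ℤ.+ + (j' * c))             ≡⟨ cong₂ (λ p q → (F ℤ.+ p) ℤ.- (F ℤ.+ q)) (ℤP.pos-* i' c) (ℤP.pos-* j' c) ⟩
      (F ℤ.+ + i' ℤ.* + c) ℤ.- (F ℤ.+ + j' ℤ.* + c)         ≡⟨ difference F (+ i') (+ j') (+ c) ⟩
      + c ℤ.* (+ i' ℤ.- + j')                                ∎
      where
      i' = toℕ i
      j' = toℕ j
      F = + colour 0

  congruent⇒extension : ∀ {ε} i j a b → ε ≤ 1 → Congruent (m + ε) i j a b → Extendable i j a b
  congruent⇒extension {ε} i j a b ε≤1 a-b≈c[i-j] = φ , φ-colouring , φi≡a , φj≡b
    where
    open import Relation.Binary.Reasoning.Setoid ≈-setoid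
    c = m + ε

    X : Fin k → ℤ
    X u = + toℕ a ℤ.+ (+ toℕ u ℤ.- + toℕ i) ℤ.* + c

    φ : Fin k → Fin k
    φ u = residue (X u)

    φi≡a : φ i ≡ a
    φi≡a = residue-unique (X i) a (≈-reflexive (X-at-i (+ toℕ a) (+ toℕ i) (+ c)))
      where
      X-at-i : ∀ A I C → A ℤ.+ (I ℤ.- I) ℤ.* C ≡ A
      X-at-i = ℤRing.solve-∀

    φj≡b : φ j ≡ b
    φj≡b = residue-unique (X j) b (≈-by-difference (X-at-j (+ toℕ a) (+ toℕ b) (+ toℕ i) (+ toℕ j) (+ c)) a-b≈c[i-j])
      where
      X-at-j : ∀ A B I J C → (A ℤ.- B) ℤ.- C ℤ.* (I ℤ.- J) ≡ (A ℤ.+ (J ℤ.- I) ℤ.* C) ℤ.- B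
      X-at-j = ℤRing.solve-∀

    X-step : ∀ u v → Succ k u v → X v ≈ X u ℤ.+ + c
    X-step u v (inj₁ v≡1+u) = begin
      X v                                           ≡⟨ cong (λ n → + toℕ a ℤ.+ (+ n ℤ.- + toℕ i) ℤ.* + c) v≡1+u ⟩
      + toℕ a ℤ.+ (+ 1 ℤ.+ + toℕ u ℤ.- + toℕ i) ℤ.* + c ≡⟨ shift (+ toℕ a) (+ toℕ u) (+ toℕ i) (+ c) ⟩
      X u ℤ.+ + c                                   ∎
      where
      shift : ∀ A U I C → A ℤ.+ (+ 1 ℤ.+ U ℤ.- I) ℤ.* C ≡ (A ℤ.+ (U ℤ.- I) ℤ.* C) ℤ.+ C
      shift = ℤRing.solve-∀
    X-step u v (inj₂ (1+u≡k , v≡0)) = ≈-sym (begin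
      X u ℤ.+ + c                                  ≡⟨ wrap-around (+ toℕ a) (+ toℕ u) (+ toℕ i) (+ c) ⟩
      X′ 0 ℤ.+ + c ℤ.* + suc (toℕ u)               ≡⟨ cong₂ (λ n p → X′ n ℤ.+ + c ℤ.* + p) (sym v≡0) 1+u≡k ⟩
      X v ℤ.+ + c ℤ.* + k                          ≈⟨ +-multiple (X v) (+ c) ⟩
      X v                                          ∎)
      where
      X′ : ℕ → ℤ
      X′ n = + toℕ a ℤ.+ (+ n ℤ.- + toℕ i) ℤ.* + c
      wrap-around : ∀ A U I C →
        (A ℤ.+ (U ℤ.- I) ℤ.* C) ℤ.+ C ≡ (A ℤ.+ (+ 0 ℤ.- I) ℤ.* C) ℤ.+ C ℤ.* (+ 1 ℤ.+ U)
      wrap-around = ℤRing.solve-∀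

    step-of-edge : ∀ u v → Succ k u v → Adjacent (toℕ (φ u)) (toℕ (φ v))
    step-of-edge u v s = step⇒adjacent (FinP.toℕ<n (φ u)) (FinP.toℕ<n (φ v)) (ε , ε≤1 , (begin
      + toℕ (φ v)           ≈⟨ residue-≈ (X v) ⟩
      X v                   ≈⟨ X-step u v s ⟩
      X u ℤ.+ + c           ≈⟨ +-cong (residue-≈ (X u)) (≈-reflexive refl) ⟨
      + toℕ (φ u) ℤ.+ + c   ∎))

    φ-colouring : IsCkColoringCycle k φ
    φ-colouring u v (inj₁ s) = adjacent⇒okPair {φ u} {φ v} (step-of-edge u v s)
    φ-colouring u v (inj₂ s) =
      adjacent⇒okPair {φ u} {φ v} (adjacent-sym {toℕ (φ v)} {toℕ (φ u)} (step-of-edge v u s))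

  extendable⇔congruent : ∀ i j a b → Extendable i j a b ⇔
    ((+ toℕ a ℤ.- + toℕ b) ≡ (+ ((k ∸ 1) / 2)) ℤ.* (+ toℕ i ℤ.- + toℕ j) [mod k ]
    ⊎ (+ toℕ a ℤ.- + toℕ b) ≡ (+ ((k + 1) / 2)) ℤ.* (+ toℕ i ℤ.- + toℕ j) [mod k ])
  extendable⇔congruent i j a b = mk⇔ (by-step-size ∘ extension⇒congruent) from
    where
    Condition : ℕ → Set
    Condition c = (+ toℕ a ℤ.- + toℕ b) ≡ (+ c) ℤ.* (+ toℕ i ℤ.- + toℕ j) [mod k ]

    m+0≡[k∸1]/2 : m + 0 ≡ (k ∸ 1) / 2
    m+0≡[k∸1]/2 = trans (ℕP.+-identityʳ m) (sym [k∸1]/2≡m)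

    m+1≡[k+1]/2 : m + 1 ≡ (k + 1) / 2
    m+1≡[k+1]/2 = trans (ℕP.+-comm m 1) (sym [k+1]/2≡1+m)

    by-step-size : ∃[ ε ] ε ≤ 1 × Congruent (m + ε) i j a b → Condition ((k ∸ 1) / 2) ⊎ Condition ((k + 1) / 2)
    by-step-size (_ , z≤n , congruent) = inj₁ (unwrap (subst (λ c → Congruent c i j a b) m+0≡[k∸1]/2 congruent))
    by-step-size (_ , s≤s z≤n , congruent) = inj₂ (unwrap (subst (λ c → Congruent c i j a b) m+1≡[k+1]/2 congruent))

    from : Condition ((k ∸ 1) / 2) ⊎ Condition ((k + 1) / 2) → Extendable i j a b
    from (inj₁ condition) = congruent⇒extension i j a b z≤n
      (subst (λ c → Congruent c i j a b) (sym m+0≡[k∸1]/2) (wrap condition))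
    from (inj₂ condition) = congruent⇒extension i j a b (s≤s z≤n)
      (subst (λ c → Congruent c i j a b) (sym m+1≡[k+1]/2) (wrap condition))

odd⇒≡suc[k/2+k/2] : ∀ {k} → k % 2 ≡ 1 → k ≡ suc (k / 2 + k / 2)
odd⇒≡suc[k/2+k/2] {k} k%2≡1 = trans (m≡m%n+[m/n]*n k 2) (cong₂ _+_ k%2≡1 (n*2≡n+n (k / 2)))
  where
  n*2≡n+n : ∀ n → n * 2 ≡ n + n
  n*2≡n+n = ℕRing.solve-∀

lemma2p1 : (k : ℕ) → 3 ≤ k → k % 2 ≡ 1 →
    (i j : Fin k) (a b : Fin k) →
    (i ≡ j → a ≡ b) →
    (CycleAdj k i j → OkPair k a b) →
    ((∃ λ φ → IsCkColoringCycle k φ × φ i ≡ a × φ j ≡ b)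
      ⇔ (((+ toℕ a ℤ.- + toℕ b) ≡ (+ ((k ∸ 1) / 2)) ℤ.* (+ toℕ i ℤ.- + toℕ j) [mod k ])
         ⊎ ((+ toℕ a ℤ.- + toℕ b) ≡ (+ ((k + 1) / 2)) ℤ.* (+ toℕ i ℤ.- + toℕ j) [mod k ])))
lemma2p1 k _ k-odd i j a b _ _ with k / 2 | odd⇒≡suc[k/2+k/2] {k} k-odd
... | m | refl = OddCycle.extendable⇔congruent m i j a b
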